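{- Let $2k+1$ be a prime and let $G$ and $H$ be finite simple graphs. If both $G$ and $H$ admit a $(2k+1)$-neighborhood balanced coloring, then so does the strong product $G\boxtimes H$.
   Context: For a prime $2k+1$ (with $k\ge 1$), a $(2k+1)$-neighborhood balanced coloring of a finite simple graph is an assignment to each vertex of one of $2k+1$ colors $R_1,\dots,R_{2k+1}$ such that every vertex has an equal number of neighbors of each color. The strong product $G\boxtimes H$ has vertex set $V(G)\times V(H)$, with $(u,v)$ and $(u',v')$ adjacent if and only if either $u=u'$ and $vv'\in E(H)$, or $v=v'$ and $uu'\in E(G)$, or $uu'\in E(G)$ and $vv'\in E(H)$. -}

module Defs where

open import Data.Nat using (ℕ; suc; _*_; _+_)
open import Data.Fin using (Fin; remQuot)
open import Data.Fin.Properties using (_≟_)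
open import Data.List using (List; length; filter)
open import Data.List.Base using (allFin)
open import Data.Product using (_×_; _,_; proj₁; proj₂; ∃)
open import Data.Sum using (_⊎_; inj₁; inj₂)
open import Relation.Nullary using (¬_; Dec; yes; no)
open import Relation.Nullary.Decidable using (_×-dec_; _⊎-dec_)
open import Relation.Binary.PropositionalEquality using (_≡_) renaming (sym to ≡-sym)

record Graph (n : ℕ) : Set₁ where
  field
    Adj   : Fin n → Fin n → Set
    adj?  : ∀ u v → Dec (Adj u v)
    sym   : ∀ {u v} → Adj u v → Adj v u
    irrefl : ∀ {u} → ¬ Adj u u
open Graph public

nbrCount : ∀ {n r} → Graph n → (Fin n → Fin r) → Fin n → Fin r → ℕ
nbrCount G c v i =
  length (filter (λ u → adj? G v u ×-dec (c u ≟ i)) (allFin _))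

IsNBC : ∀ {n} (r : ℕ) → Graph n → (Fin n → Fin r) → Set
IsNBC r G c = ∀ v i j → nbrCount G c v i ≡ nbrCount G c v j

HasNBC : ∀ {n} (r : ℕ) → Graph n → Set
HasNBC r G = ∃ λ c → IsNBC r G c

SPAdj₂ : ∀ {m n} → Graph m → Graph n → Fin m × Fin n → Fin m × Fin n → Set
SPAdj₂ G H (u , v) (u' , v') =
  (u ≡ u' × Adj H v v') ⊎ (v ≡ v' × Adj G u u') ⊎ (Adj G u u' × Adj H v v')

-- strong product; vertex set Fin (m * n) identified with Fin m × Fin n
-- via remQuot (the inverse of Data.Fin.combine)
strongProduct : ∀ {m n} → Graph m → Graph n → Graph (m * n)
strongProduct {m} {n} G H = record
  { Adj = λ x y → SPAdj₂ G H (remQuot {m} n x) (remQuot {m} n y)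
  ; adj? = λ x y → dec (remQuot {m} n x) (remQuot {m} n y)
  ; sym = λ {x} {y} → sy (remQuot {m} n x) (remQuot {m} n y)
  ; irrefl = λ {x} → irr (remQuot {m} n x)
  }
  where
  dec : ∀ p q → Dec (SPAdj₂ G H p q)
  dec (u , v) (u' , v') =
    ((u ≟ u') ×-dec adj? H v v') ⊎-dec ((v ≟ v') ×-dec adj? G u u')
      ⊎-dec (adj? G u u' ×-dec adj? H v v')
  sy : ∀ p q → SPAdj₂ G H p q → SPAdj₂ G H q p
  sy (u , v) (u' , v') (inj₁ (e , a)) = inj₁ (≡-sym e , Graph.sym H a)
  sy (u , v) (u' , v') (inj₂ (inj₁ (e , a))) = inj₂ (inj₁ (≡-sym e , Graph.sym G a))
  sy (u , v) (u' , v') (inj₂ (inj₂ (a , b))) = inj₂ (inj₂ (Graph.sym G a , Graph.sym H b))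
  irr : ∀ p → ¬ SPAdj₂ G H p p
  irr (u , v) (inj₁ (_ , a)) = irrefl H a
  irr (u , v) (inj₂ (inj₁ (_ , a))) = irrefl G a
  irr (u , v) (inj₂ (inj₂ (a , _))) = irrefl G a

-- Colour (u , v) by c u + d v modulo r, where c and d are balanced colourings of
-- G and H. A neighbour of (u , v) in the strong product is a neighbour in the
-- H-row of u, in the G-column of v, or a diagonal neighbour (u' , v') with
-- u' ~ u and v' ~ v. Along every row and column the colouring is a rotation of d
-- or c, hence still balanced, so each of the three kinds of neighbours is
-- equidistributed among the colours.
module Submission where

open import Defs
open import Data.Nat using (ℕ; suc; _*_; _+_)
open import Data.Nat.Primality using (Prime)

open import Data.Nat.Properties using (+-*-semiring; +-assoc; +-comm; +-identityʳ; m+[n∸m]≡n; m∸n+n≡m; <⇒≤)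
open import Algebra.Properties.Semiring.Sum +-*-semiring
  using (sum; sum-syntax; sum-cong-≗; ∑-distrib-+; *-distribˡ-sum; sum-replicate-zero)
open import Data.Bool.Base using (if_then_else_)
open import Data.Empty using (⊥)
open import Data.Fin using (Fin; zero; suc; toℕ; remQuot; combine; _↑ˡ_; _↑ʳ_)
open import Data.Fin.Permutation using (Permutation; permutation; _⟨$⟩ʳ_; _⟨$⟩ˡ_; inverseˡ; inverseʳ)
open import Data.Fin.Properties using (_≟_; toℕ-injective; toℕ-fromℕ<; toℕ<n; remQuot-combine)
open import Data.List using (length; filter; tabulate; allFin)
open import Data.List.Properties using (filter-≐)
open import Data.Nat as ℕ using (_∸_; NonZero)
open import Data.Nat.DivMod using (_%_; _mod_; %-distribˡ-+; m%n%n≡m%n; [m+n]%n≡m%n; m<n⇒m%n≡m)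
open import Data.Nat.Tactic.RingSolver using (solve-∀)
open import Data.Product using (_×_; _,_; proj₁; proj₂; uncurry)
open import Data.Sum using (inj₁; inj₂)
open import Function using (_∘_; id)
open import Relation.Nullary using (Dec; yes; no; does)
open import Relation.Nullary.Decidable using (_×-dec_; _⊎-dec_)
open import Relation.Unary using (Pred; Decidable)
open import Relation.Binary.PropositionalEquality
  using (_≡_; refl; cong; cong₂; subst; trans; module ≡-Reasoning) renaming (sym to ≡-sym)

𝟙 : ∀ {a} {A : Set a} → Dec A → ℕ
𝟙 a? = if does a? then 1 else 0

𝟙-cong : ∀ {a b} {A : Set a} {B : Set b} → (A → B) → (B → A) →
         (a? : Dec A) (b? : Dec B) → 𝟙 a? ≡ 𝟙 b?
𝟙-cong A→B B→A (yes a) (yes b) = refl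
𝟙-cong A→B B→A (no ¬a) (no ¬b) = refl
𝟙-cong A→B B→A (yes a) (no ¬b) with () ← ¬b (A→B a)
𝟙-cong A→B B→A (no ¬a) (yes b) with () ← ¬a (B→A b)

𝟙-× : ∀ {a b} {A : Set a} {B : Set b} (a? : Dec A) (b? : Dec B) →
      𝟙 (a? ×-dec b?) ≡ 𝟙 a? * 𝟙 b?
𝟙-× (yes a) (yes b) = refl
𝟙-× (yes a) (no ¬b) = refl
𝟙-× (no ¬a) b?      = refl

𝟙-⊎ : ∀ {a b} {A : Set a} {B : Set b} → (A → B → ⊥) →
      (a? : Dec A) (b? : Dec B) → 𝟙 (a? ⊎-dec b?) ≡ 𝟙 a? + 𝟙 b?
𝟙-⊎ disjoint (yes a) (yes b) with () ← disjoint a b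
𝟙-⊎ disjoint (yes a) (no ¬b) = refl
𝟙-⊎ disjoint (no ¬a) b?      = refl

∑-δ : ∀ {N} (a : Fin N) (h : Fin N → ℕ) → ∑[ x < N ] (𝟙 (a ≟ x) * h x) ≡ h a
∑-δ {suc N} zero h = begin
  h zero + 0 + sum (λ (x : Fin N) → 0) ≡⟨ cong (h zero + 0 +_) (sum-replicate-zero N) ⟩
  h zero + 0 + 0                      ≡⟨ trans (+-identityʳ _) (+-identityʳ _) ⟩
  h zero                              ∎
  where open ≡-Reasoning
∑-δ {suc N} (suc a) h = ∑-δ a (h ∘ suc)

∑-↑ : ∀ a {b} (g : Fin (a + b) → ℕ) → sum g ≡ sum (g ∘ (_↑ˡ b)) + sum (g ∘ (a ↑ʳ_))
∑-↑ ℕ.zero    g = refl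
∑-↑ (ℕ.suc a) g = trans (cong (g zero +_) (∑-↑ a (g ∘ suc))) (≡-sym (+-assoc (g zero) _ _))

∑-combine : ∀ {m n} (g : Fin (m * n) → ℕ) →
            sum g ≡ ∑[ u < m ] ∑[ v < n ] g (combine u v)
∑-combine {ℕ.zero}  g = refl
∑-combine {ℕ.suc m} {n} g =
  trans (∑-↑ n g) (cong (sum (g ∘ (_↑ˡ (m * n))) +_) (∑-combine {m} {n} (g ∘ (n ↑ʳ_))))

length-filter-tabulate : ∀ {a p} {A : Set a} {P : Pred A p} (P? : Decidable P) {N} (f : Fin N → A) →
                         length (filter P? (tabulate f)) ≡ ∑[ x < N ] 𝟙 (P? (f x))
length-filter-tabulate P? {ℕ.zero}  f = refl
length-filter-tabulate P? {ℕ.suc N} f with P? (f zero)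
... | yes _ = cong suc (length-filter-tabulate P? (f ∘ suc))
... | no  _ = length-filter-tabulate P? (f ∘ suc)

nbrCount≡∑ : ∀ {n r} (G : Graph n) (c : Fin n → Fin r) v i →
             nbrCount G c v i ≡ ∑[ u < n ] (𝟙 (adj? G v u) * 𝟙 (c u ≟ i))
nbrCount≡∑ G c v i =
  trans (length-filter-tabulate (λ u → adj? G v u ×-dec (c u ≟ i)) id) (sum-cong-≗ (λ u → 𝟙-× (adj? G v u) (c u ≟ i)))

nbrCount-relabel : ∀ {n r s} (G : Graph n) (π : Permutation r s) {c : Fin n → Fin r} {c′ : Fin n → Fin s} →
                   (∀ u → c′ u ≡ π ⟨$⟩ʳ c u) → ∀ v i → nbrCount G c′ v i ≡ nbrCount G c v (π ⟨$⟩ˡ i)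
nbrCount-relabel {n} G π {c} {c′} c′≡πc v i =
  cong length (filter-≐ (λ u → adj? G v u ×-dec (c′ u ≟ i))
                        (λ u → adj? G v u ×-dec (c u ≟ π ⟨$⟩ˡ i))
                        (to , from) (allFin n))
  where
  to : ∀ {u} → Adj G v u × c′ u ≡ i → Adj G v u × c u ≡ π ⟨$⟩ˡ i
  to {u} (vu , c′u≡i) = vu , trans (≡-sym (inverseˡ π)) (cong (π ⟨$⟩ˡ_) (trans (≡-sym (c′≡πc u)) c′u≡i))
  from : ∀ {u} → Adj G v u × c u ≡ π ⟨$⟩ˡ i → Adj G v u × c′ u ≡ i
  from {u} (vu , cu≡π⁻¹i) = vu , trans (c′≡πc u) (trans (cong (π ⟨$⟩ʳ_) cu≡π⁻¹i) (inverseʳ π))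

IsNBC-relabel : ∀ {n r s} (G : Graph n) (π : Permutation r s) {c : Fin n → Fin r} {c′ : Fin n → Fin s} →
                (∀ u → c′ u ≡ π ⟨$⟩ʳ c u) → IsNBC r G c → IsNBC s G c′
IsNBC-relabel G π c′≡πc balanced v i j = begin
  nbrCount G _ v i           ≡⟨ nbrCount-relabel G π c′≡πc v i ⟩
  nbrCount G _ v (π ⟨$⟩ˡ i)  ≡⟨ balanced v _ _ ⟩
  nbrCount G _ v (π ⟨$⟩ˡ j)  ≡⟨ nbrCount-relabel G π c′≡πc v j ⟨
  nbrCount G _ v j           ∎
  where open ≡-Reasoning

module _ {m n} (G : Graph m) (H : Graph n) where

  spAdj? : ∀ p q → Dec (SPAdj₂ G H p q)
  spAdj? (u , v) (u′ , v′) =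
    ((u ≟ u′) ×-dec adj? H v v′) ⊎-dec ((v ≟ v′) ×-dec adj? G u u′)
      ⊎-dec (adj? G u u′ ×-dec adj? H v v′)

  -- The three kinds of adjacency are mutually exclusive because G and H are loopless.
  𝟙-spAdj : ∀ u v u′ v′ → 𝟙 (spAdj? (u , v) (u′ , v′)) ≡
            𝟙 (u ≟ u′) * 𝟙 (adj? H v v′) + (𝟙 (v ≟ v′) * 𝟙 (adj? G u u′) + 𝟙 (adj? G u u′) * 𝟙 (adj? H v v′))
  𝟙-spAdj u v u′ v′ = begin
    𝟙 (inRow ⊎-dec (inColumn ⊎-dec diagonal))
      ≡⟨ 𝟙-⊎ (λ { (refl , _) → λ { (inj₁ (_ , uu)) → irrefl G uu ; (inj₂ (uu , _)) → irrefl G uu } })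
             inRow (inColumn ⊎-dec diagonal) ⟩
    𝟙 inRow + 𝟙 (inColumn ⊎-dec diagonal)
      ≡⟨ cong (𝟙 inRow +_) (𝟙-⊎ (λ { (refl , _) (_ , vv) → irrefl H vv }) inColumn diagonal) ⟩
    𝟙 inRow + (𝟙 inColumn + 𝟙 diagonal)
      ≡⟨ cong₂ _+_ (𝟙-× (u ≟ u′) (adj? H v v′))
                   (cong₂ _+_ (𝟙-× (v ≟ v′) (adj? G u u′)) (𝟙-× (adj? G u u′) (adj? H v v′))) ⟩
    𝟙 (u ≟ u′) * 𝟙 (adj? H v v′) + (𝟙 (v ≟ v′) * 𝟙 (adj? G u u′) + 𝟙 (adj? G u u′) * 𝟙 (adj? H v v′))
      ∎
    where
    open ≡-Reasoning
    inRow    = (u ≟ u′) ×-dec adj? H v v′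
    inColumn = (v ≟ v′) ×-dec adj? G u u′
    diagonal = adj? G u u′ ×-dec adj? H v v′

  𝟙-strongProduct-adj : ∀ x u′ v′ →
    𝟙 (adj? (strongProduct G H) x (combine u′ v′)) ≡ 𝟙 (spAdj? (remQuot {m} n x) (u′ , v′))
  𝟙-strongProduct-adj x u′ v′ = 𝟙-cong (subst (SPAdj₂ G H (remQuot {m} n x)) eq)
                                       (subst (SPAdj₂ G H (remQuot {m} n x)) (≡-sym eq))
                                       (adj? (strongProduct G H) x (combine u′ v′))
                                       (spAdj? (remQuot {m} n x) (u′ , v′))
    where
    eq : remQuot {m} n (combine u′ v′) ≡ (u′ , v′)
    eq = remQuot-combine u′ v′

  nbrCount-strongProduct : ∀ {r} (φ : Fin m → Fin n → Fin r) x i →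
    let (u , v) = remQuot {m} n x in
    nbrCount (strongProduct G H) (uncurry φ ∘ remQuot n) x i ≡
      nbrCount H (φ u) v i + (nbrCount G (λ u′ → φ u′ v) u i
        + ∑[ u′ < m ] (𝟙 (adj? G u u′) * nbrCount H (φ u′) v i))
  nbrCount-strongProduct φ x i = begin
    nbrCount (strongProduct G H) _ x i
      ≡⟨ nbrCount≡∑ (strongProduct G H) _ x i ⟩
    sum (λ y → 𝟙 (adj? (strongProduct G H) x y) * 𝟙 (uncurry φ (remQuot {m} n y) ≟ i))
      ≡⟨ ∑-combine {m} {n} _ ⟩
    ∑[ u′ < m ] ∑[ v′ < n ] (𝟙 (adj? (strongProduct G H) x (combine u′ v′))
                             * 𝟙 (uncurry φ (remQuot {m} n (combine u′ v′)) ≟ i))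
      ≡⟨ sum-cong-≗ (λ u′ → sum-cong-≗ (split u′)) ⟩
    ∑[ u′ < m ] ∑[ v′ < n ] (row u′ v′ + (column u′ v′ + diagonal u′ v′))
      ≡⟨ sum-cong-≗ (λ u′ → trans (∑-distrib-+ (row u′) _) (cong (sum (row u′) +_) (∑-distrib-+ (column u′) (diagonal u′)))) ⟩
    ∑[ u′ < m ] (sum (row u′) + (sum (column u′) + sum (diagonal u′)))
      ≡⟨ trans (∑-distrib-+ (sum ∘ row) _) (cong (sum (sum ∘ row) +_) (∑-distrib-+ (sum ∘ column) (sum ∘ diagonal))) ⟩
    ∑[ u′ < m ] sum (row u′) + (∑[ u′ < m ] sum (column u′) + ∑[ u′ < m ] sum (diagonal u′))
      ≡⟨ cong₂ _+_ rowTerm (cong₂ _+_ columnTerm diagonalTerm) ⟩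
    nbrCount H (φ u) v i + (nbrCount G (λ u′ → φ u′ v) u i + ∑[ u′ < m ] (Aɢ u′ * nbrCount H (φ u′) v i))
      ∎
    where
    open ≡-Reasoning
    u = proj₁ (remQuot {m} n x)
    v = proj₂ (remQuot {m} n x)
    Aɢ : Fin m → ℕ
    Aɢ u′ = 𝟙 (adj? G u u′)
    Aₕ : Fin n → ℕ
    Aₕ v′ = 𝟙 (adj? H v v′)
    E : Fin m → Fin n → ℕ
    E u′ v′ = 𝟙 (φ u′ v′ ≟ i)
    row column diagonal : Fin m → Fin n → ℕ
    row      u′ v′ = 𝟙 (u ≟ u′) * (Aₕ v′ * E u′ v′)
    column   u′ v′ = 𝟙 (v ≟ v′) * (Aɢ u′ * E u′ v′)
    diagonal u′ v′ = Aɢ u′ * (Aₕ v′ * E u′ v′)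

    split : ∀ u′ v′ → 𝟙 (adj? (strongProduct G H) x (combine u′ v′)) * 𝟙 (uncurry φ (remQuot {m} n (combine u′ v′)) ≟ i)
                    ≡ row u′ v′ + (column u′ v′ + diagonal u′ v′)
    split u′ v′ = begin
      _ ≡⟨ cong₂ _*_ (trans (𝟙-strongProduct-adj x u′ v′) (𝟙-spAdj u v u′ v′))
                     (cong (λ p → 𝟙 (uncurry φ p ≟ i)) (remQuot-combine u′ v′)) ⟩
      (𝟙 (u ≟ u′) * Aₕ v′ + (𝟙 (v ≟ v′) * Aɢ u′ + Aɢ u′ * Aₕ v′)) * E u′ v′
        ≡⟨ distrib (𝟙 (u ≟ u′)) (𝟙 (v ≟ v′)) (Aɢ u′) (Aₕ v′) (E u′ v′) ⟩
      _ ∎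
      where
      distrib : ∀ a b g h e → (a * h + (b * g + g * h)) * e ≡ a * (h * e) + (b * (g * e) + g * (h * e))
      distrib = solve-∀

    rowTerm : ∑[ u′ < m ] sum (row u′) ≡ nbrCount H (φ u) v i
    rowTerm = begin
      ∑[ u′ < m ] sum (row u′)                           ≡⟨ sum-cong-≗ (λ u′ → *-distribˡ-sum (𝟙 (u ≟ u′)) (λ v′ → Aₕ v′ * E u′ v′)) ⟨
      ∑[ u′ < m ] (𝟙 (u ≟ u′) * ∑[ v′ < n ] (Aₕ v′ * E u′ v′)) ≡⟨ ∑-δ u (λ u′ → ∑[ v′ < n ] (Aₕ v′ * E u′ v′)) ⟩
      ∑[ v′ < n ] (Aₕ v′ * E u v′)                       ≡⟨ nbrCount≡∑ H (φ u) v i ⟨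
      nbrCount H (φ u) v i                               ∎

    columnTerm : ∑[ u′ < m ] sum (column u′) ≡ nbrCount G (λ u′ → φ u′ v) u i
    columnTerm = trans (sum-cong-≗ (λ u′ → ∑-δ v (λ v′ → Aɢ u′ * E u′ v′)))
                       (≡-sym (nbrCount≡∑ G (λ u′ → φ u′ v) u i))

    diagonalTerm : ∑[ u′ < m ] sum (diagonal u′) ≡ ∑[ u′ < m ] (Aɢ u′ * nbrCount H (φ u′) v i)
    diagonalTerm = sum-cong-≗ (λ u′ →
      trans (≡-sym (*-distribˡ-sum (Aɢ u′) (λ v′ → Aₕ v′ * E u′ v′)))
            (cong (Aɢ u′ *_) (≡-sym (nbrCount≡∑ H (φ u′) v i))))

  IsNBC-strongProduct : ∀ {r} (φ : Fin m → Fin n → Fin r) →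
    (∀ u → IsNBC r H (φ u)) → (∀ v → IsNBC r G (λ u → φ u v)) →
    IsNBC r (strongProduct G H) (uncurry φ ∘ remQuot n)
  IsNBC-strongProduct φ rows columns x i j = begin
    _ ≡⟨ nbrCount-strongProduct φ x i ⟩
    _ ≡⟨ cong₂ _+_ (rows u v i j)
                   (cong₂ _+_ (columns v u i j)
                              (sum-cong-≗ (λ u′ → cong (𝟙 (adj? G u u′) *_) (rows u′ v i j)))) ⟩
    _ ≡⟨ nbrCount-strongProduct φ x j ⟨
    _ ∎
    where
    open ≡-Reasoning
    u = proj₁ (remQuot {m} n x)
    v = proj₂ (remQuot {m} n x)

module _ {r : ℕ} .{{_ : NonZero r}} where

  infixl 6 _+ₘ_

  _+ₘ_ : Fin r → Fin r → Fin r
  a +ₘ b = (toℕ a + toℕ b) mod r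

  +ₘ-comm : ∀ a b → a +ₘ b ≡ b +ₘ a
  +ₘ-comm a b = cong (_mod r) (+-comm (toℕ a) (toℕ b))

  private
    [m+n%r]%r≡[m+n]%r : ∀ m n → (m + n % r) % r ≡ (m + n) % r
    [m+n%r]%r≡[m+n]%r m n = begin
      (m + n % r) % r           ≡⟨ %-distribˡ-+ m (n % r) r ⟩
      (m % r + n % r % r) % r   ≡⟨ cong (λ k → (m % r + k) % r) (m%n%n≡m%n n r) ⟩
      (m % r + n % r) % r       ≡⟨ %-distribˡ-+ m n r ⟨
      (m + n) % r               ∎
      where open ≡-Reasoning

    [r+a]%r≡a : (a : Fin r) → (r + toℕ a) % r ≡ toℕ a
    [r+a]%r≡a a = trans (cong (_% r) (+-comm r (toℕ a)))
                        (trans ([m+n]%n≡m%n (toℕ a) r) (m<n⇒m%n≡m (toℕ<n a)))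

  rotate : Fin r → Permutation r r
  rotate a = permutation (a +ₘ_) (λ i → (r ∸ toℕ a + toℕ i) mod r) rotate∘unrotate unrotate∘rotate
    where
    open ≡-Reasoning
    a≤r = <⇒≤ (toℕ<n a)

    rotate∘unrotate : ∀ i → a +ₘ (r ∸ toℕ a + toℕ i) mod r ≡ i
    rotate∘unrotate i = toℕ-injective (begin
      toℕ (a +ₘ (r ∸ toℕ a + toℕ i) mod r)          ≡⟨ toℕ-fromℕ< _ ⟩
      (toℕ a + toℕ ((r ∸ toℕ a + toℕ i) mod r)) % r  ≡⟨ cong (λ k → (toℕ a + k) % r) (toℕ-fromℕ< _) ⟩
      (toℕ a + (r ∸ toℕ a + toℕ i) % r) % r          ≡⟨ [m+n%r]%r≡[m+n]%r (toℕ a) _ ⟩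
      (toℕ a + (r ∸ toℕ a + toℕ i)) % r              ≡⟨ cong (_% r) (+-assoc (toℕ a) _ _) ⟨
      (toℕ a + (r ∸ toℕ a) + toℕ i) % r              ≡⟨ cong (λ k → (k + toℕ i) % r) (m+[n∸m]≡n a≤r) ⟩
      (r + toℕ i) % r                                ≡⟨ [r+a]%r≡a i ⟩
      toℕ i                                          ∎)

    unrotate∘rotate : ∀ b → (r ∸ toℕ a + toℕ (a +ₘ b)) mod r ≡ b
    unrotate∘rotate b = toℕ-injective (begin
      toℕ ((r ∸ toℕ a + toℕ (a +ₘ b)) mod r)         ≡⟨ toℕ-fromℕ< _ ⟩
      (r ∸ toℕ a + toℕ (a +ₘ b)) % r                 ≡⟨ cong (λ k → (r ∸ toℕ a + k) % r) (toℕ-fromℕ< _) ⟩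
      (r ∸ toℕ a + (toℕ a + toℕ b) % r) % r          ≡⟨ [m+n%r]%r≡[m+n]%r (r ∸ toℕ a) _ ⟩
      (r ∸ toℕ a + (toℕ a + toℕ b)) % r              ≡⟨ cong (_% r) (+-assoc (r ∸ toℕ a) _ _) ⟨
      (r ∸ toℕ a + toℕ a + toℕ b) % r                ≡⟨ cong (λ k → (k + toℕ b) % r) (m∸n+n≡m a≤r) ⟩
      (r + toℕ b) % r                                ≡⟨ [r+a]%r≡a b ⟩
      toℕ b                                          ∎)

theorem2p12 : (k m n : ℕ) → Prime (suc (2 * k)) → (G : Graph m) → (H : Graph n)
    → HasNBC (suc (2 * k)) G → HasNBC (suc (2 * k)) H
    → HasNBC (suc (2 * k)) (strongProduct G H)
theorem2p12 k m n _ G H (c , c-balanced) (d , d-balanced) =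
  uncurry φ ∘ remQuot {m} n , IsNBC-strongProduct G H φ rowsBalanced columnsBalanced
  where
  φ : Fin m → Fin n → Fin (suc (2 * k))
  φ u v = c u +ₘ d v

  rowsBalanced : ∀ u → IsNBC (suc (2 * k)) H (φ u)
  rowsBalanced u = IsNBC-relabel H (rotate (c u)) (λ v → refl) d-balanced

  columnsBalanced : ∀ v → IsNBC (suc (2 * k)) G (λ u → φ u v)
  columnsBalanced v = IsNBC-relabel G (rotate (d v)) (λ u → +ₘ-comm (c u) (d v)) c-balanced
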